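{- Let $\{H_n\}_{n\in\mathbb{N}}$ be finite graphs and $f_n:V(H_{n+1})\to V(H_n)$ maps such that for every edge $\{v,w\}$ of $H_{n+1}$ either $f_n(v)=f_n(w)$ or $\{f_n(v),f_n(w)\}$ is an edge of $H_n$. Suppose $\{H_n\}$ is a bounded-degree expander family and there is a constant $c$ with $2\le|f_n^{ -1}(v)|\le c$ for all $n$ and all $v\in V(H_n)$. For $N\in\mathbb{N}$ let $T_N$ be the graph with vertex set $\bigsqcup_{n=1}^{N+1}V(H_n)$ whose edges are the edges of each $H_n$ ($n\le N+1$) together with the edges $\{v,f_n(v)\}$ for $n\le N$ and $v\in V(H_{n+1})$ (this is the $1$-skeleton of the mapping telescope of $f_1,\dots,f_N$). Then $\{T_N\}_{N\in\mathbb{N}}$ is a bounded-degree expander family.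
   Context: A family of finite graphs $\{G_n\}$ is a bounded-degree expander family if vertex degrees are uniformly bounded and there is $\alpha>0$ such that for all $n$ and all $A\subseteq V(G_n)$ with $|A|\le\frac12|V(G_n)|$, the number of edges between $A$ and $V(G_n)\setminus A$ is at least $\alpha|A|$. -}

module Defs where

open import Data.Nat using (ℕ; zero; suc; _+_; _*_; _≤_; _<_)
open import Data.Bool using (Bool; true; false; if_then_else_; _∧_; not)
open import Data.Fin using (Fin; zero; suc; splitAt; _↑ʳ_; _≟_)
open import Data.Sum using (_⊎_; inj₁; inj₂)
open import Data.Product using (Σ; _×_; _,_; proj₁; proj₂)
open import Relation.Binary.PropositionalEquality using (_≡_)
open import Relation.Nullary.Decidable using (⌊_⌋)

record Graph : Set where
  constructor mkGraph
  field
    size : ℕ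
    adj  : Fin size → Fin size → Bool
open Graph public

record IsSimple (G : Graph) : Set where
  field
    adj-sym   : ∀ v w → adj G v w ≡ adj G w v
    adj-irrefl : ∀ v → adj G v v ≡ false

count : ∀ {n} → (Fin n → Bool) → ℕ
count {zero}  p = 0
count {suc n} p = (if p zero then 1 else 0) + count (λ i → p (suc i))

sumFin : ∀ {n} → (Fin n → ℕ) → ℕ
sumFin {zero}  g = 0
sumFin {suc n} g = g zero + sumFin (λ i → g (suc i))

degree : (G : Graph) → Fin (size G) → ℕ
degree G v = count (adj G v)

-- number of edges between A and its complement (each such edge {a,b}, a ∈ A, b ∉ A,
-- is counted once, as the ordered pair (a , b))
edgeBoundary : (G : Graph) → (Fin (size G) → Bool) → ℕ
edgeBoundary G A =
  sumFin (λ a → if A a then count (λ b → not (A b) ∧ adj G a b) else 0)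

-- Bounded-degree expander family; the constant α > 0 is written as p / q with p, q > 0.
IsExpanderFamily : (ℕ → Graph) → Set
IsExpanderFamily G =
  Σ ℕ λ d → (∀ n (v : Fin (size (G n))) → degree (G n) v ≤ d) ×
  Σ ℕ λ p → Σ ℕ λ q → 0 < p × 0 < q ×
    (∀ n (A : Fin (size (G n)) → Bool) → 2 * count A ≤ size (G n) →
       p * count A ≤ q * edgeBoundary (G n) A)

IsGraphMap : (G H : Graph) → (Fin (size G) → Fin (size H)) → Set
IsGraphMap G H f = ∀ v w → adj G v w ≡ true → (f v ≡ f w) ⊎ (adj H (f v) (f w) ≡ true)

fibreSize : ∀ {m n} → (Fin m → Fin n) → Fin n → ℕ
fibreSize f v = count (λ u → ⌊ f u ≟ v ⌋)

-- Mapping telescope 1-skeleton built from H 0, …, H N (H 0 plays the role of the paper's H_1),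
-- together with the inclusion of the last block H N.
telescope′ : (H : ℕ → Graph) → (f : ∀ n → Fin (size (H (suc n))) → Fin (size (H n))) →
             (N : ℕ) → Σ Graph (λ T → Fin (size (H N)) → Fin (size T))
telescope′ H f zero = H zero , λ v → v
telescope′ H f (suc N) = mkGraph (size T + size (H (suc N))) a , (λ v → size T ↑ʳ v)
  where
  T = proj₁ (telescope′ H f N)
  ι = proj₂ (telescope′ H f N)
  a : Fin (size T + size (H (suc N))) → Fin (size T + size (H (suc N))) → Bool
  a x y with splitAt (size T) x | splitAt (size T) y
  ... | inj₁ u | inj₁ w = adj T u w
  ... | inj₂ u | inj₂ w = adj (H (suc N)) u w
  ... | inj₁ u | inj₂ w = ⌊ u ≟ ι (f N w) ⌋
  ... | inj₂ u | inj₁ w = ⌊ w ≟ ι (f N u) ⌋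

telescope : (H : ℕ → Graph) → (f : ∀ n → Fin (size (H (suc n))) → Fin (size (H n))) → ℕ → Graph
telescope H f N = proj₁ (telescope′ H f N)

-- Every fibre of f_N
-- has at least two points, and a point w of the fibre over a vertex of A either lies in A or
-- the edge {w, f_N w} leaves A; hence 2 |A ∩ H_N| ≤ |A ∩ H_(N+1)| + (edges of that kind),
-- and induction on N gives  |A| ≤ 2 |A ∩ H_N| + |∂A|  for every set A of vertices of T_N.
-- If A ∩ H_N is at most half of H_N, the expansion of H_N bounds |A ∩ H_N| by the edges of
-- H_N leaving A, which lie in ∂A.  Otherwise the same argument applies to the complement of
-- A, which is at least as large as A and has the same boundary.  Each vertex gains at most
-- one edge down and c edges up, so degrees stay at most d + 1 + c.
module Submission where

open import Defs
open import Data.Nat using (ℕ; zero; suc; _+_; _*_; _≤_; _<_; z≤n; s≤s; _≤?_)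
open import Data.Nat.Properties
  using ( +-assoc; +-suc; +-identityʳ; *-identityˡ; *-comm; ≤-refl; ≤-reflexive; ≤-trans
        ; +-mono-≤; +-monoˡ-≤; *-monoˡ-≤; *-monoʳ-≤; m≤m+n; m≤n+m; +-cancelˡ-≤; +-cancelˡ-<
        ; <⇒≤; ≰⇒>; n≤1+n; +-monoʳ-≤; module ≤-Reasoning; +-*-semiring )
open import Data.Nat.Tactic.RingSolver using (solve-∀)
open import Data.Bool using (Bool; true; false; if_then_else_; _∧_; not)
open import Data.Bool.Properties using (∧-identityʳ; ∧-zeroʳ; not-involutive; ∧-commutativeMonoid)
open import Data.Fin using (Fin; zero; suc; _↑ˡ_; _↑ʳ_; splitAt; _≟_)
open import Data.Fin.Properties using (splitAt⁻¹-↑ˡ; splitAt⁻¹-↑ʳ; splitAt-↑ˡ; splitAt-↑ʳ; ↑ʳ-injective; any?)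
open import Data.Product using (Σ; _×_; _,_; proj₁; proj₂)
open import Data.Sum using (inj₁; inj₂)
open import Function using (_∘_)
open import Function.Definitions using (Injective)
open import Relation.Binary.PropositionalEquality
open import Relation.Nullary using (¬_; yes; no; contradiction)
open import Relation.Nullary.Decidable using (⌊_⌋; isYes≗does; dec-false)
open import Algebra.Bundles using (CommutativeMonoid)
open import Algebra.Properties.CommutativeSemigroup
  (CommutativeMonoid.commutativeSemigroup ∧-commutativeMonoid)
  using () renaming (x∙yz≈y∙xz to ∧-leftComm)
open import Algebra.Properties.Semiring.Sum +-*-semiring
  using (sum; sum-syntax; sum-cong-≗; ∑-comm; ∑-distrib-+; *-distribˡ-sum)

𝟙 : Bool → ℕ
𝟙 b = if b then 1 else 0

sumFin≡sum : ∀ {n} (g : Fin n → ℕ) → sumFin g ≡ sum g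
sumFin≡sum {zero}  g = refl
sumFin≡sum {suc n} g = cong (g zero +_) (sumFin≡sum (g ∘ suc))

sum-mono-≤ : ∀ {n} {g h : Fin n → ℕ} → (∀ i → g i ≤ h i) → sum g ≤ sum h
sum-mono-≤ {zero}  _   = z≤n
sum-mono-≤ {suc n} g≤h = +-mono-≤ (g≤h zero) (sum-mono-≤ (g≤h ∘ suc))

sum-splitAt : ∀ m {n} (g : Fin (m + n) → ℕ) → sum g ≡ sum (g ∘ (_↑ˡ n)) + sum (g ∘ (m ↑ʳ_))
sum-splitAt zero    g = refl
sum-splitAt (suc m) {n} g =
  trans (cong (g zero +_) (sum-splitAt m (g ∘ suc)))
        (sym (+-assoc (g zero) (sum (g ∘ suc ∘ (_↑ˡ n))) (sum (g ∘ suc ∘ (m ↑ʳ_)))))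

count≡sum : ∀ {n} (p : Fin n → Bool) → count p ≡ ∑[ i < n ] 𝟙 (p i)
count≡sum {zero}  p = refl
count≡sum {suc n} p = cong (𝟙 (p zero) +_) (count≡sum (p ∘ suc))

count-cong : ∀ {n} {p q : Fin n → Bool} → (∀ i → p i ≡ q i) → count p ≡ count q
count-cong {p = p} {q} p≗q =
  trans (count≡sum p) (trans (sum-cong-≗ (cong 𝟙 ∘ p≗q)) (sym (count≡sum q)))

count-false : ∀ {n} (p : Fin n → Bool) → (∀ i → p i ≡ false) → count p ≡ 0
count-false {zero}  p _        = refl
count-false {suc n} p p≡false rewrite p≡false zero = count-false (p ∘ suc) (p≡false ∘ suc)

count-splitAt : ∀ m {n} (p : Fin (m + n) → Bool) → count p ≡ count (p ∘ (_↑ˡ n)) + count (p ∘ (m ↑ʳ_))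
count-splitAt zero    p = refl
count-splitAt (suc m) {n} p =
  trans (cong (𝟙 (p zero) +_) (count-splitAt m (p ∘ suc)))
        (sym (+-assoc (𝟙 (p zero)) (count (p ∘ suc ∘ (_↑ˡ n))) (count (p ∘ suc ∘ (m ↑ʳ_)))))

count-complement : ∀ {n} (p : Fin n → Bool) → count p + count (not ∘ p) ≡ n
count-complement {zero}  p = refl
count-complement {suc n} p with p zero
... | true  = cong suc (count-complement (p ∘ suc))
... | false = trans (+-suc _ _) (cong suc (count-complement (p ∘ suc)))

count-∧ˡ : ∀ {n} b (p : Fin n → Bool) → count (λ i → b ∧ p i) ≡ 𝟙 b * count p
count-∧ˡ true  p = sym (*-identityˡ (count p))
count-∧ˡ false p = count-false (λ i → false ∧ p i) (λ _ → refl)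

count-≤-+-∧-not : ∀ {n} (p q : Fin n → Bool) → count q ≤ count p + count (λ i → q i ∧ not (p i))
count-≤-+-∧-not {n} p q = begin
  count q                                              ≡⟨ count≡sum q ⟩
  ∑[ i < n ] 𝟙 (q i)                                   ≤⟨ sum-mono-≤ (λ i → 𝟙-≤ (p i) (q i)) ⟩
  ∑[ i < n ] (𝟙 (p i) + 𝟙 (q∖p i))                     ≡⟨ ∑-distrib-+ (𝟙 ∘ p) (𝟙 ∘ q∖p) ⟩
  ∑[ i < n ] 𝟙 (p i) + ∑[ i < n ] 𝟙 (q∖p i)            ≡⟨ sym (cong₂ _+_ (count≡sum p) (count≡sum q∖p)) ⟩
  count p + count q∖p                                  ∎
  where
  open ≤-Reasoning
  q∖p : Fin n → Bool
  q∖p i = q i ∧ not (p i)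
  𝟙-≤ : ∀ a b → 𝟙 b ≤ 𝟙 a + 𝟙 (b ∧ not a)
  𝟙-≤ true  true  = s≤s z≤n
  𝟙-≤ false true  = ≤-refl
  𝟙-≤ _     false = z≤n

sum-count-comm : ∀ {m n} (R : Fin m → Fin n → Bool) →
                 ∑[ a < m ] count (R a) ≡ ∑[ b < n ] count (λ a → R a b)
sum-count-comm R =
  trans (sum-cong-≗ (λ a → count≡sum (R a)))
        (trans (∑-comm (λ a b → 𝟙 (R a b))) (sum-cong-≗ (λ b → sym (count≡sum (λ a → R a b)))))

≤-count-complement : ∀ {n} (p : Fin n → Bool) → 2 * count p ≤ n → count p ≤ count (not ∘ p)
≤-count-complement {n} p 2|p|≤n = +-cancelˡ-≤ (count p) _ _ (begin
  count p + count p          ≡⟨ cong (count p +_) (sym (+-identityʳ (count p))) ⟩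
  2 * count p                ≤⟨ 2|p|≤n ⟩
  n                          ≡⟨ sym (count-complement p) ⟩
  count p + count (not ∘ p)  ∎)
  where open ≤-Reasoning

count-complement-small : ∀ {n} (p : Fin n → Bool) → ¬ (2 * count p ≤ n) → 2 * count (not ∘ p) ≤ n
count-complement-small {n} p 2|p|≰n = begin
  2 * count (not ∘ p)             ≡⟨ cong (count (not ∘ p) +_) (+-identityʳ _) ⟩
  count (not ∘ p) + count (not ∘ p) ≤⟨ +-monoˡ-≤ (count (not ∘ p)) (<⇒≤ (+-cancelˡ-< (count p) _ _ n<2|p|)) ⟩
  count p + count (not ∘ p)       ≡⟨ count-complement p ⟩
  n                               ∎
  where
  open ≤-Reasoning
  n<2|p| : count p + count (not ∘ p) < count p + count p
  n<2|p| = subst₂ _<_ (sym (count-complement p)) (cong (count p +_) (+-identityʳ (count p))) (≰⇒> 2|p|≰n)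

⌊≟⌋-sym : ∀ {n} (x y : Fin n) → ⌊ x ≟ y ⌋ ≡ ⌊ y ≟ x ⌋
⌊≟⌋-sym x y with x ≟ y | y ≟ x
... | yes _   | yes _   = refl
... | no  _   | no  _   = refl
... | yes x≡y | no  y≢x = contradiction (sym x≡y) y≢x
... | no  x≢y | yes y≡x = contradiction (sym y≡x) x≢y

⌊suc≟suc⌋ : ∀ {n} (x y : Fin n) → ⌊ suc x ≟ suc y ⌋ ≡ ⌊ x ≟ y ⌋
⌊suc≟suc⌋ x y with x ≟ y
... | yes _ = refl
... | no  _ = refl

⌊≟⌋-injective : ∀ {m n} {ι : Fin m → Fin n} → Injective _≡_ _≡_ ι →
                ∀ x y → ⌊ ι x ≟ ι y ⌋ ≡ ⌊ x ≟ y ⌋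
⌊≟⌋-injective {ι = ι} ι-inj x y with ι x ≟ ι y | x ≟ y
... | yes _     | yes _   = refl
... | no  _     | no  _   = refl
... | yes ιx≡ιy | no  x≢y = contradiction (ι-inj ιx≡ιy) x≢y
... | no  ιx≢ιy | yes x≡y = contradiction (cong ι x≡y) ιx≢ιy

count-∧-∧-≟ : ∀ {n} (P Q : Fin n → Bool) x → count (λ u → P u ∧ Q u ∧ ⌊ u ≟ x ⌋) ≡ 𝟙 (P x ∧ Q x)
count-∧-∧-≟ {suc n} P Q zero =
  trans (cong₂ _+_ (cong (𝟙 ∘ (P zero ∧_)) (∧-identityʳ (Q zero)))
                   (count-false _ (λ u → ∧-∧-false (P (suc u)) (Q (suc u)))))
        (+-identityʳ _)
  where
  ∧-∧-false : ∀ a b → a ∧ b ∧ false ≡ false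
  ∧-∧-false a b = trans (cong (a ∧_) (∧-zeroʳ b)) (∧-zeroʳ a)
count-∧-∧-≟ {suc n} P Q (suc x) =
  cong₂ _+_ (cong 𝟙 (trans (cong (P zero ∧_) (∧-zeroʳ (Q zero))) (∧-zeroʳ (P zero))))
            (trans (count-cong (λ u → cong (λ e → P (suc u) ∧ Q (suc u) ∧ e) (⌊suc≟suc⌋ u x)))
                   (count-∧-∧-≟ (P ∘ suc) (Q ∘ suc) x))

count-∘ : ∀ {m n} (g : Fin m → Fin n) (B : Fin n → Bool) →
          count (B ∘ g) ≡ ∑[ v < n ] (𝟙 (B v) * fibreSize g v)
count-∘ {m} {n} g B = begin
  count (B ∘ g)
    ≡⟨ count≡sum (B ∘ g) ⟩
  ∑[ w < m ] 𝟙 (B (g w))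
    ≡⟨ sum-cong-≗ (λ w → sym (count-∧-∧-≟ (λ _ → true) B (g w))) ⟩
  ∑[ w < m ] count (λ v → B v ∧ ⌊ v ≟ g w ⌋)
    ≡⟨ sum-count-comm (λ w v → B v ∧ ⌊ v ≟ g w ⌋) ⟩
  ∑[ v < n ] count (λ w → B v ∧ ⌊ v ≟ g w ⌋)
    ≡⟨ sum-cong-≗ (λ v → count-∧ˡ (B v) (λ w → ⌊ v ≟ g w ⌋)) ⟩
  ∑[ v < n ] (𝟙 (B v) * count (λ w → ⌊ v ≟ g w ⌋))
    ≡⟨ sum-cong-≗ (λ v → cong (𝟙 (B v) *_) (count-cong (⌊≟⌋-sym v ∘ g))) ⟩
  ∑[ v < n ] (𝟙 (B v) * fibreSize g v)
    ∎
  where open ≡-Reasoning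

*-count-≤-count-∘ : ∀ {m n} k (g : Fin m → Fin n) → (∀ v → k ≤ fibreSize g v) →
                    ∀ B → k * count B ≤ count (B ∘ g)
*-count-≤-count-∘ {n = n} k g k≤fibre B = begin
  k * count B                           ≡⟨ cong (k *_) (count≡sum B) ⟩
  k * ∑[ v < n ] 𝟙 (B v)                ≡⟨ *-distribˡ-sum k (𝟙 ∘ B) ⟩
  ∑[ v < n ] (k * 𝟙 (B v))                ≤⟨ sum-mono-≤ (λ v → *-monoˡ-≤ (𝟙 (B v)) (k≤fibre v)) ⟩
  ∑[ v < n ] (fibreSize g v * 𝟙 (B v))    ≡⟨ sum-cong-≗ (λ v → *-comm (fibreSize g v) (𝟙 (B v))) ⟩
  ∑[ v < n ] (𝟙 (B v) * fibreSize g v)    ≡⟨ sym (count-∘ g B) ⟩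
  count (B ∘ g)                         ∎
  where open ≤-Reasoning

fibreSize-∘-injective : ∀ {l m n} {ι : Fin m → Fin n} → Injective _≡_ _≡_ ι →
                        ∀ (g : Fin l → Fin m) v → fibreSize (ι ∘ g) (ι v) ≡ fibreSize g v
fibreSize-∘-injective ι-inj g v = count-cong (λ w → ⌊≟⌋-injective ι-inj (g w) v)

fibreSize-∉-image : ∀ {m n} (g : Fin m → Fin n) u → (∀ w → g w ≢ u) → fibreSize g u ≡ 0
fibreSize-∉-image g u u∉img =
  count-false _ (λ w → trans (isYes≗does (g w ≟ u)) (dec-false (g w ≟ u) (u∉img w)))

edgesBetween : (G : Graph) → (A B : Fin (size G) → Bool) → ℕ
edgesBetween G A B = ∑[ a < size G ] count (λ b → A a ∧ B b ∧ adj G a b)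

boundary : (G : Graph) → (Fin (size G) → Bool) → ℕ
boundary G A = edgesBetween G A (not ∘ A)

edgeBoundary≡boundary : ∀ G A → edgeBoundary G A ≡ boundary G A
edgeBoundary≡boundary G A = trans (sumFin≡sum {size G} _) (sum-cong-≗ row)
  where
  row : ∀ a → (if A a then count (λ b → not (A b) ∧ adj G a b) else 0)
            ≡ count (λ b → A a ∧ not (A b) ∧ adj G a b)
  row a with A a
  ... | true  = refl
  ... | false = sym (count-false (λ b → false ∧ not (A b) ∧ adj G a b) (λ _ → refl))

edgesBetween-comm : ∀ G → (∀ v w → adj G v w ≡ adj G w v) →
                    ∀ A B → edgesBetween G A B ≡ edgesBetween G B A
edgesBetween-comm G adj-sym A B =
  trans (sum-count-comm (λ a b → A a ∧ B b ∧ adj G a b))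
        (sum-cong-≗ λ b → count-cong λ a →
          trans (∧-leftComm (A a) (B b) _) (cong (λ e → B b ∧ A a ∧ e) (adj-sym a b)))

boundary-complement : ∀ G → (∀ v w → adj G v w ≡ adj G w v) →
                      ∀ A → boundary G (not ∘ A) ≡ boundary G A
boundary-complement G adj-sym A =
  trans (sum-cong-≗ λ a → count-cong λ b → cong (λ x → not (A a) ∧ x ∧ adj G a b) (not-involutive (A b)))
        (edgesBetween-comm G adj-sym (not ∘ A) A)

HasExpansion : ℕ → ℕ → Graph → Set
HasExpansion p q G = ∀ A → 2 * count A ≤ size G → p * count A ≤ q * edgeBoundary G A

data SplitAt (m n : ℕ) : Fin (m + n) → Set where
  left  : (u : Fin m) → SplitAt m n (u ↑ˡ n)
  right : (v : Fin n) → SplitAt m n (m ↑ʳ v)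

splitAt-view : ∀ m n (x : Fin (m + n)) → SplitAt m n x
splitAt-view m n x with splitAt m x in eq
... | inj₁ u = subst (SplitAt m n) (splitAt⁻¹-↑ˡ eq) (left u)
... | inj₂ v = subst (SplitAt m n) (splitAt⁻¹-↑ʳ eq) (right v)

module _ (H : ℕ → Graph) (f : ∀ n → Fin (size (H (suc n))) → Fin (size (H n))) where

  private
    T : ℕ → Graph
    T = telescope H f

  top : ∀ N → Fin (size (H N)) → Fin (size (T N))
  top N = proj₂ (telescope′ H f N)

  top-injective : ∀ N → Injective _≡_ _≡_ (top N)
  top-injective zero    = λ eq → eq
  top-injective (suc N) = ↑ʳ-injective (size (T N)) _ _

  module Step (N : ℕ) where
    m n : ℕ
    m = size (T N)
    n = size (H (suc N))

    ↓ : Fin n → Fin m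
    ↓ w = top N (f N w)

    adj-↑ˡ-↑ˡ : ∀ u w → adj (T (suc N)) (u ↑ˡ n) (w ↑ˡ n) ≡ adj (T N) u w
    adj-↑ˡ-↑ˡ u w rewrite splitAt-↑ˡ m u n | splitAt-↑ˡ m w n = refl

    adj-↑ʳ-↑ʳ : ∀ v w → adj (T (suc N)) (m ↑ʳ v) (m ↑ʳ w) ≡ adj (H (suc N)) v w
    adj-↑ʳ-↑ʳ v w rewrite splitAt-↑ʳ m n v | splitAt-↑ʳ m n w = refl

    adj-↑ˡ-↑ʳ : ∀ u w → adj (T (suc N)) (u ↑ˡ n) (m ↑ʳ w) ≡ ⌊ u ≟ ↓ w ⌋
    adj-↑ˡ-↑ʳ u w rewrite splitAt-↑ˡ m u n | splitAt-↑ʳ m n w = refl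

    adj-↑ʳ-↑ˡ : ∀ v w → adj (T (suc N)) (m ↑ʳ v) (w ↑ˡ n) ≡ ⌊ w ≟ ↓ v ⌋
    adj-↑ʳ-↑ˡ v w rewrite splitAt-↑ʳ m n v | splitAt-↑ˡ m w n = refl

    degree-↑ˡ : ∀ u → degree (T (suc N)) (u ↑ˡ n) ≡ degree (T N) u + fibreSize ↓ u
    degree-↑ˡ u =
      trans (count-splitAt m _)
            (cong₂ _+_ (count-cong (adj-↑ˡ-↑ˡ u))
                       (count-cong (λ w → trans (adj-↑ˡ-↑ʳ u w) (⌊≟⌋-sym u (↓ w)))))

    degree-↑ʳ : ∀ v → degree (T (suc N)) (m ↑ʳ v) ≡ suc (degree (H (suc N)) v)
    degree-↑ʳ v =
      trans (count-splitAt m _)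
            (cong₂ _+_ (trans (count-cong (adj-↑ʳ-↑ˡ v)) (count-∧-∧-≟ (λ _ → true) (λ _ → true) (↓ v)))
                       (count-cong (adj-↑ʳ-↑ʳ v)))

    edgesBetween-suc : ∀ A B →
      edgesBetween (T (suc N)) A B ≡
        (edgesBetween (T N) (A ∘ (_↑ˡ n)) (B ∘ (_↑ˡ n)) + count (λ w → A (↓ w ↑ˡ n) ∧ B (m ↑ʳ w)))
      + (count (λ v → A (m ↑ʳ v) ∧ B (↓ v ↑ˡ n)) + edgesBetween (H (suc N)) (A ∘ (m ↑ʳ_)) (B ∘ (m ↑ʳ_)))
    edgesBetween-suc A B = begin
      edgesBetween (T (suc N)) A B
        ≡⟨ sum-splitAt m _ ⟩
      ∑[ u < m ] row (u ↑ˡ n) + ∑[ v < n ] row (m ↑ʳ v)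
        ≡⟨ cong₂ _+_ (split-rows (_↑ˡ n)) (split-rows (m ↑ʳ_)) ⟩
      (∑[ u < m ] count (λ w → R (u ↑ˡ n) (w ↑ˡ n)) + ∑[ u < m ] count (λ w → R (u ↑ˡ n) (m ↑ʳ w)))
      + (∑[ v < n ] count (λ w → R (m ↑ʳ v) (w ↑ˡ n)) + ∑[ v < n ] count (λ w → R (m ↑ʳ v) (m ↑ʳ w)))
        ≡⟨ cong₂ _+_ (cong₂ _+_ lower-edges down-edges) (cong₂ _+_ up-edges upper-edges) ⟩
      _ ∎
      where
      open ≡-Reasoning
      R : Fin (m + n) → Fin (m + n) → Bool
      R x y = A x ∧ B y ∧ adj (T (suc N)) x y
      row : Fin (m + n) → ℕ
      row x = count (R x)
      split-rows : ∀ {k} (r : Fin k → Fin (m + n)) →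
        ∑[ i < k ] row (r i)
        ≡ ∑[ i < k ] count (λ w → R (r i) (w ↑ˡ n)) + ∑[ i < k ] count (λ w → R (r i) (m ↑ʳ w))
      split-rows r =
        trans (sum-cong-≗ (λ i → count-splitAt m (R (r i))))
              (∑-distrib-+ (λ i → count (λ w → R (r i) (w ↑ˡ n))) (λ i → count (λ w → R (r i) (m ↑ʳ w))))
      lower-edges : ∑[ u < m ] count (λ w → R (u ↑ˡ n) (w ↑ˡ n))
                  ≡ edgesBetween (T N) (A ∘ (_↑ˡ n)) (B ∘ (_↑ˡ n))
      lower-edges = sum-cong-≗ λ u → count-cong λ w →
        cong (λ e → A (u ↑ˡ n) ∧ B (w ↑ˡ n) ∧ e) (adj-↑ˡ-↑ˡ u w)
      upper-edges : ∑[ v < n ] count (λ w → R (m ↑ʳ v) (m ↑ʳ w))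
                  ≡ edgesBetween (H (suc N)) (A ∘ (m ↑ʳ_)) (B ∘ (m ↑ʳ_))
      upper-edges = sum-cong-≗ λ v → count-cong λ w →
        cong (λ e → A (m ↑ʳ v) ∧ B (m ↑ʳ w) ∧ e) (adj-↑ʳ-↑ʳ v w)
      down-edges : ∑[ u < m ] count (λ w → R (u ↑ˡ n) (m ↑ʳ w)) ≡ count (λ w → A (↓ w ↑ˡ n) ∧ B (m ↑ʳ w))
      down-edges =
        trans (sum-count-comm (λ u w → R (u ↑ˡ n) (m ↑ʳ w)))
              (trans (sum-cong-≗ λ w →
                        trans (count-cong (λ u → cong (λ e → A (u ↑ˡ n) ∧ B (m ↑ʳ w) ∧ e) (adj-↑ˡ-↑ʳ u w)))
                              (count-∧-∧-≟ (A ∘ (_↑ˡ n)) (λ _ → B (m ↑ʳ w)) (↓ w)))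
                     (sym (count≡sum (λ w → A (↓ w ↑ˡ n) ∧ B (m ↑ʳ w)))))
      up-edges : ∑[ v < n ] count (λ w → R (m ↑ʳ v) (w ↑ˡ n)) ≡ count (λ v → A (m ↑ʳ v) ∧ B (↓ v ↑ˡ n))
      up-edges =
        trans (sum-cong-≗ λ v →
                 trans (count-cong (λ w → cong (λ e → A (m ↑ʳ v) ∧ B (w ↑ˡ n) ∧ e) (adj-↑ʳ-↑ˡ v w)))
                       (count-∧-∧-≟ (λ _ → A (m ↑ʳ v)) (B ∘ (_↑ˡ n)) (↓ v)))
              (sym (count≡sum (λ v → A (m ↑ʳ v) ∧ B (↓ v ↑ˡ n))))

    module Blocks (A : Fin (m + n) → Bool) where
      A↓ : Fin m → Bool
      A↓ = A ∘ (_↑ˡ n)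
      A↑ : Fin n → Bool
      A↑ = A ∘ (m ↑ʳ_)
      leavingDown leavingUp : ℕ
      leavingDown = count (λ w → A↓ (↓ w) ∧ not (A↑ w))
      leavingUp   = count (λ v → A↑ v ∧ not (A↓ (↓ v)))

      boundary-suc : boundary (T (suc N)) A
                   ≡ (boundary (T N) A↓ + leavingDown) + (leavingUp + boundary (H (suc N)) A↑)
      boundary-suc = edgesBetween-suc A (not ∘ A)

      boundary-↑ˡ-≤ : boundary (T N) A↓ + leavingDown ≤ boundary (T (suc N)) A
      boundary-↑ˡ-≤ = ≤-trans (m≤m+n (boundary (T N) A↓ + leavingDown) (leavingUp + boundary (H (suc N)) A↑))
                              (≤-reflexive (sym boundary-suc))

      boundary-↑ʳ-≤ : boundary (H (suc N)) A↑ ≤ boundary (T (suc N)) A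
      boundary-↑ʳ-≤ = ≤-trans (m≤n+m (boundary (H (suc N)) A↑) leavingUp)
                        (≤-trans (m≤n+m (leavingUp + boundary (H (suc N)) A↑) (boundary (T N) A↓ + leavingDown))
                                 (≤-reflexive (sym boundary-suc)))

    adj-sym-suc : (∀ u w → adj (T N) u w ≡ adj (T N) w u) →
                  (∀ v w → adj (H (suc N)) v w ≡ adj (H (suc N)) w v) →
                  ∀ x y → adj (T (suc N)) x y ≡ adj (T (suc N)) y x
    adj-sym-suc T-sym H-sym x y with splitAt-view m n x | splitAt-view m n y
    ... | left u  | left w  = trans (adj-↑ˡ-↑ˡ u w) (trans (T-sym u w) (sym (adj-↑ˡ-↑ˡ w u)))
    ... | left u  | right w = trans (adj-↑ˡ-↑ʳ u w) (sym (adj-↑ʳ-↑ˡ w u))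
    ... | right v | left w  = trans (adj-↑ʳ-↑ˡ v w) (sym (adj-↑ˡ-↑ʳ w v))
    ... | right v | right w = trans (adj-↑ʳ-↑ʳ v w) (trans (H-sym v w) (sym (adj-↑ʳ-↑ʳ w v)))

  adj-telescope-sym : (∀ N v w → adj (H N) v w ≡ adj (H N) w v) →
                      ∀ N x y → adj (T N) x y ≡ adj (T N) y x
  adj-telescope-sym H-sym zero    = H-sym zero
  adj-telescope-sym H-sym (suc N) = Step.adj-sym-suc N (adj-telescope-sym H-sym N) (H-sym (suc N))

  telescope-degree-≤ : ∀ d c → (∀ N v → degree (H N) v ≤ d) → (∀ N v → fibreSize (f N) v ≤ c) →
                       ∀ N → (∀ x → degree (T N) x ≤ suc d + c) × (∀ v → degree (T N) (top N v) ≤ suc d)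
  telescope-degree-≤ d c deg≤d fibre≤c zero =
    (λ x → ≤-trans (deg≤d 0 x) (≤-trans (n≤1+n d) (m≤m+n (suc d) c))) , (λ v → ≤-trans (deg≤d 0 v) (n≤1+n d))
  telescope-degree-≤ d c deg≤d fibre≤c (suc N) = all-≤ , top-≤
    where
    open Step N
    ih : (∀ x → degree (T N) x ≤ suc d + c) × (∀ v → degree (T N) (top N v) ≤ suc d)
    ih = telescope-degree-≤ d c deg≤d fibre≤c N
    top-≤ : ∀ v → degree (T (suc N)) (m ↑ʳ v) ≤ suc d
    top-≤ v = subst (_≤ suc d) (sym (degree-↑ʳ v)) (s≤s (deg≤d (suc N) v))
    lower-≤ : ∀ u → degree (T N) u + fibreSize ↓ u ≤ suc d + c
    lower-≤ u with any? (λ v → top N v ≟ u)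
    ... | yes (v , refl) =
      +-mono-≤ (proj₂ ih v)
               (subst (_≤ c) (sym (fibreSize-∘-injective (top-injective N) (f N) v)) (fibre≤c N v))
    ... | no  u∉img =
      subst (_≤ suc d + c)
            (sym (trans (cong (degree (T N) u +_) (fibreSize-∉-image ↓ u (λ w eq → u∉img (f N w , eq))))
                        (+-identityʳ _)))
            (proj₁ ih u)
    all-≤ : ∀ x → degree (T (suc N)) x ≤ suc d + c
    all-≤ x with splitAt-view m n x
    ... | left u  = subst (_≤ suc d + c) (sym (degree-↑ˡ u)) (lower-≤ u)
    ... | right v = ≤-trans (top-≤ v) (m≤m+n (suc d) c)

  boundary-top-≤ : ∀ N A → boundary (H N) (A ∘ top N) ≤ boundary (T N) A
  boundary-top-≤ zero    A = ≤-refl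
  boundary-top-≤ (suc N) A = Step.Blocks.boundary-↑ʳ-≤ N A

  count-≤-top : (∀ N v → 2 ≤ fibreSize (f N) v) →
                ∀ N A → count A ≤ 2 * count (A ∘ top N) + boundary (T N) A
  count-≤-top fibre≥2 zero    A = ≤-trans (m≤m+n (count A) (count A + 0)) (m≤m+n _ _)
  count-≤-top fibre≥2 (suc N) A = begin
    count A                                          ≡⟨ count-splitAt m A ⟩
    count A↓ + count A↑                              ≤⟨ +-monoˡ-≤ (count A↑) (count-≤-top fibre≥2 N A↓) ⟩
    (2 * count (A↓ ∘ top N) + boundary (T N) A↓) + count A↑
      ≤⟨ +-monoˡ-≤ (count A↑) (+-monoˡ-≤ (boundary (T N) A↓) lower-≤-upper) ⟩
    ((count A↑ + leavingDown) + boundary (T N) A↓) + count A↑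
      ≡⟨ rearrange (count A↑) leavingDown (boundary (T N) A↓) ⟩
    2 * count A↑ + (boundary (T N) A↓ + leavingDown) ≤⟨ +-monoʳ-≤ (2 * count A↑) boundary-↑ˡ-≤ ⟩
    2 * count A↑ + boundary (T (suc N)) A            ∎
    where
    open Step N
    open Blocks A
    open ≤-Reasoning
    lower-≤-upper : 2 * count (A↓ ∘ top N) ≤ count A↑ + leavingDown
    lower-≤-upper = ≤-trans (*-count-≤-count-∘ 2 (f N) (fibre≥2 N) (A↓ ∘ top N))
                            (count-≤-+-∧-not A↑ (A↓ ∘ ↓))
    rearrange : ∀ t v e → (t + v + e) + t ≡ 2 * t + (e + v)
    rearrange = solve-∀

  expansion-via-top : (∀ N v → 2 ≤ fibreSize (f N) v) → ∀ {p q} → (∀ N → HasExpansion p q (H N)) →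
                      ∀ N S → 2 * count (S ∘ top N) ≤ size (H N) → p * count S ≤ (2 * q + p) * boundary (T N) S
  expansion-via-top fibre≥2 {p} {q} H-exp N S small = begin
    p * count S                     ≤⟨ *-monoʳ-≤ p (count-≤-top fibre≥2 N S) ⟩
    p * (2 * s + ∂S)                ≡⟨ distrib p s ∂S ⟩
    2 * (p * s) + p * ∂S            ≤⟨ +-monoˡ-≤ (p * ∂S) (*-monoʳ-≤ 2 top-expansion) ⟩
    2 * (q * ∂S) + p * ∂S           ≡⟨ collect q p ∂S ⟩
    (2 * q + p) * ∂S                ∎
    where
    open ≤-Reasoning
    s ∂S : ℕ
    s  = count (S ∘ top N)
    ∂S = boundary (T N) S
    top-expansion : p * s ≤ q * ∂S
    top-expansion =
      ≤-trans (subst ((p * s ≤_) ∘ (q *_)) (edgeBoundary≡boundary (H N) (S ∘ top N))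
                     (H-exp N (S ∘ top N) small))
              (*-monoʳ-≤ q (boundary-top-≤ N S))
    distrib : ∀ p s e → p * (2 * s + e) ≡ 2 * (p * s) + p * e
    distrib = solve-∀
    collect : ∀ q p e → 2 * (q * e) + p * e ≡ (2 * q + p) * e
    collect = solve-∀

  telescope-expansion : (∀ N v w → adj (H N) v w ≡ adj (H N) w v) → (∀ N v → 2 ≤ fibreSize (f N) v) →
                        ∀ {p q} → (∀ N → HasExpansion p q (H N)) → ∀ N → HasExpansion p (2 * q + p) (T N)
  telescope-expansion H-sym fibre≥2 {p} {q} H-exp N A 2|A|≤|T| =
    subst ((p * count A ≤_) ∘ ((2 * q + p) *_)) (sym (edgeBoundary≡boundary (T N) A)) boundary-expansion
    where
    boundary-expansion : p * count A ≤ (2 * q + p) * boundary (T N) A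
    boundary-expansion with 2 * count (A ∘ top N) ≤? size (H N)
    ... | yes small = expansion-via-top fibre≥2 {p} {q} H-exp N A small
    ... | no  large = begin
      p * count A                              ≤⟨ *-monoʳ-≤ p (≤-count-complement A 2|A|≤|T|) ⟩
      p * count (not ∘ A)                      ≤⟨ expansion-via-top fibre≥2 {p} {q} H-exp N (not ∘ A)
                                                    (count-complement-small (A ∘ top N) large) ⟩
      (2 * q + p) * boundary (T N) (not ∘ A)   ≡⟨ cong ((2 * q + p) *_)
                                                    (boundary-complement (T N) (adj-telescope-sym H-sym N) A) ⟩
      (2 * q + p) * boundary (T N) A           ∎
      where open ≤-Reasoning

proposition9p4 : (H : ℕ → Graph) (f : ∀ n → Fin (size (H (suc n))) → Fin (size (H n))) →
    (∀ n → IsSimple (H n)) →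
    (∀ n → IsGraphMap (H (suc n)) (H n) (f n)) →
    IsExpanderFamily H →
    Σ ℕ (λ c → ∀ n (v : Fin (size (H n))) → 2 ≤ fibreSize (f n) v × fibreSize (f n) v ≤ c) →
    IsExpanderFamily (telescope H f)
proposition9p4 H f simple _ (d , degree≤d , p , q , 0<p , _ , H-exp) (c , fibre-bounds) =
  suc d + c , proj₁ ∘ telescope-degree-≤ H f d c degree≤d (λ N v → proj₂ (fibre-bounds N v)) ,
  p , 2 * q + p , 0<p , ≤-trans 0<p (m≤n+m p (2 * q)) ,
  telescope-expansion H f (IsSimple.adj-sym ∘ simple) (λ N v → proj₁ (fibre-bounds N v)) {p} {q} H-exp
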